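{- Let $3\le d\le 50$, let $\ell>1000$ be a prime, let $(\alpha,\beta)\in\mathcal{A}_d$, and let $y_1,y_2$ be integers satisfying \[ 4\beta y_2^\ell-\alpha^2y_1^{2\ell}=d^2-1, \] with $|y_1|\ge 2$, $y_2\ge 2$ and $y_2\ne y_1^2$. Let $A_2=\max\{y_1^2,y_2\}$. Then \[ 1\le\frac{\log A_2}{\log y_1^2}\le 1.03. \]
   Context: For a prime $q$ let $\mu_q=\mathrm{ord}_q(d^2-1)$ and $\nu_q=\mathrm{ord}_q(d)$. Associate to each prime $q$ a finite set $T_q\subset\mathbb{Z}^2$: if $q\nmid d(d^2-1)$, $T_q=\{(0,0)\}$. For $q=2$: if $2\mid d$, $T_2=\{(0,1-\nu_2)\}$; if $2\nmid d$ and $\mu_2$ is even, $T_2=\{(1,0),(\mu_2/2,1-\mu_2/2),(3-\mu_2,\mu_2-2)\}$; if $2\nmid d$ and $\mu_2$ is odd, $T_2=\{(1,0),(3-\mu_2,\mu_2-2)\}$. For odd $q\mid d$: $T_q=\{(-\nu_q,0),(0,-\nu_q)\}$. For odd $q\mid d^2-1$: if $\mu_q$ is even, $T_q=\{(0,0),(-\mu_q,\mu_q),(\mu_q/2,-\mu_q/2)\}$; if $\mu_q$ is odd, $T_q=\{(0,0),(-\mu_q,\mu_q)\}$. Then $\mathcal{A}_d$ is the set of pairs of positive rationals $(\alpha,\beta)$ with $(\mathrm{ord}_q(\alpha),\mathrm{ord}_q(\beta))\in T_q$ for every prime $q$. -}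

module Defs where

open import Data.Nat as ℕ using (ℕ; zero; suc; _∸_; _≡ᵇ_)
open import Data.Nat.Divisibility using (_∣_)
open import Data.Integer as ℤ using (ℤ; +_; -_)
open import Data.Rational as ℚ using (ℚ; 0ℚ; 1ℚ; ↥_; ↧ₙ_)
open import Data.Bool using (if_then_else_; not)
open import Data.List using (List; []; _∷_)
open import Data.List.Membership.Propositional using (_∈_)
open import Data.Nat.Primality using (Prime)
open import Data.Product using (_×_; _,_; ∃-syntax)
open import Relation.Binary.PropositionalEquality using (_≡_)
open import Relation.Nullary using (¬_)

IsOrd : ℕ → ℕ → ℕ → Set
IsOrd q n k = (q ℕ.^ k ∣ n) × ¬ (q ℕ.^ suc k ∣ n)

OrdQ : ℕ → ℚ → ℤ → Set
OrdQ q α z = ∃[ a ] ∃[ b ] (IsOrd q (ℤ.∣ ↥ α ∣) a × IsOrd q (↧ₙ α) b × z ≡ (+ a) ℤ.- (+ b))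

isEven : ℕ → Data.Bool.Bool
isEven μ = μ ℕ.% 2 ≡ᵇ 0

-- The set T_q, given q, ν = ord_q(d), μ = ord_q(d^2-1).
Tset : ℕ → ℕ → ℕ → List (ℤ × ℤ)
Tset q ν μ =
  if q ≡ᵇ 2
  then (if ν ≡ᵇ 0
        then (if isEven μ
              then ((+ 1 , + 0) ∷ (+ (μ ℕ./ 2) , + 1 ℤ.- + (μ ℕ./ 2)) ∷ (+ 3 ℤ.- + μ , + μ ℤ.- + 2) ∷ [])
              else ((+ 1 , + 0) ∷ (+ 3 ℤ.- + μ , + μ ℤ.- + 2) ∷ []))
        else ((+ 0 , + 1 ℤ.- + ν) ∷ []))
  else (if not (ν ≡ᵇ 0)
        then ((- (+ ν) , + 0) ∷ (+ 0 , - (+ ν)) ∷ [])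
        else (if not (μ ≡ᵇ 0)
              then (if isEven μ
                    then ((+ 0 , + 0) ∷ (- (+ μ) , + μ) ∷ (+ (μ ℕ./ 2) , - (+ (μ ℕ./ 2))) ∷ [])
                    else ((+ 0 , + 0) ∷ (- (+ μ) , + μ) ∷ []))
              else ((+ 0 , + 0) ∷ [])))

InA : ℕ → ℚ → ℚ → Set
InA d α β =
  (0ℚ ℚ.< α) × (0ℚ ℚ.< β) ×
  (∀ q → Prime q → ∀ ν μ x y →
     IsOrd q d ν → IsOrd q (d ℕ.* d ∸ 1) μ → OrdQ q α x → OrdQ q β y →
     (x , y) ∈ Tset q ν μ)

_^ℚ_ : ℚ → ℕ → ℚ
x ^ℚ zero = 1ℚ
x ^ℚ suc n = x ℚ.* (x ^ℚ n)

ℤtoℚ : ℤ → ℚ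
ℤtoℚ z = z ℚ./ 1

-- For every prime q the conditions T_q bound the valuations of α and β:
-- ord_q α ≤ ord_q (8(d²−1)) and −ord_q β ≤ ord_q (4d(d²−1)).  Hence the
-- numerator a of α divides 8(d²−1) and the denominator e of β divides
-- 4d(d²−1), which for d ≤ 50 makes K = (a² + d² − 1)e a constant below 2⁴⁸.
-- Clearing denominators in 4βy₂^ℓ − α²y₁^(2ℓ) = d² − 1 gives
-- y₂^ℓ ≤ K (y₁²)^ℓ, and since K¹⁰⁰ ≤ 64¹⁰⁰¹ ≤ (y₁²)^(3ℓ) for |y₁| ≥ 2 and
-- ℓ > 1000, taking ℓ-th roots yields y₂¹⁰⁰ ≤ (y₁²)¹⁰³.
module Submission where

open import Defs
open import Data.Nat as ℕ using (ℕ; _≤_; _⊔_; _∸_)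
open import Data.Nat.Primality using (Prime)
open import Data.Integer as ℤ using (ℤ; +_)
open import Data.Rational as ℚ using (ℚ)
open import Data.Product using (_×_)
open import Relation.Binary.PropositionalEquality using (_≡_; _≢_)

open import Data.Bool.Properties using (T-≡)
open import Data.Bool using (true; false)
open import Data.Nat using (zero; suc; _+_; _*_; _^_; _<_; _≡ᵇ_; s≤s; z≤n; NonZero; NonTrivial)
open import Data.Nat.Properties
open import Data.Nat.Coprimality as Coprimality using (Coprime)
open import Data.Nat.DivMod using (_/_; m/n≤m)
open import Data.Nat.Divisibility
open import Data.Nat.GCD using (gcd; gcd[m,n]∣m; gcd[m,n]∣n; gcd-greatest)
open import Data.Nat.Induction using (<-wellFounded)
open import Data.Nat.ListAction using (product)
open import Data.Nat.Primality using (prime⇒nonTrivial)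
open import Data.Nat.Primality.Factorisation using (factorise)
import Data.Nat.Tactic.RingSolver as ℕ-Ring
open import Data.Integer using (-_; -[1+_]; +≤+)
import Data.Integer.Properties as ℤP
import Data.Integer.Tactic.RingSolver as ℤ-Ring
open import Data.Rational using (mkℚ; 0ℚ; ↥_; ↧_; ↧ₙ_; toℚᵘ)
open import Data.Rational.Properties using (↥p/↧p≡p; toℚᵘ-cong; toℚᵘ-homo-*; toℚᵘ-homo-+; toℚᵘ-homo‿-)
import Data.Rational.Unnormalised as ℚᵘ
import Data.Rational.Unnormalised.Properties as ℚᵘP
open import Data.List using ([]; _∷_)
open import Data.List.Relation.Unary.All using (All; []; _∷_; lookup)
open import Data.Product using (_,_; ∃-syntax; proj₁; proj₂)
open import Data.Sum using (_⊎_; inj₁; inj₂)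
open import Function using (_∘_; Equivalence)
open import Induction.WellFounded using (Acc; acc)
open import Relation.Nullary using (¬_; yes; no; contradiction)
open import Relation.Binary.PropositionalEquality
  using (refl; sym; trans; cong; cong₂; subst; subst₂; module ≡-Reasoning)

m≤n⇒q^m∣q^n : ∀ q {m n} → m ≤ n → q ^ m ∣ q ^ n
m≤n⇒q^m∣q^n q {m} {n} m≤n = divides (q ^ (n ∸ m)) (begin
  q ^ n               ≡⟨ cong (q ^_) (m+[n∸m]≡n m≤n) ⟨
  q ^ (m + (n ∸ m))   ≡⟨ ^-distribˡ-+-* q m (n ∸ m) ⟩
  q ^ m * q ^ (n ∸ m) ≡⟨ *-comm (q ^ m) _ ⟩
  q ^ (n ∸ m) * q ^ m ∎)
  where open ≡-Reasoning

IsOrd-suc⇒∣ : ∀ {q n} k → IsOrd q n (suc k) → q ∣ n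
IsOrd-suc⇒∣ {q} k (qᵏ⁺¹∣n , _) = ∣-trans (m∣m*n (q ^ k)) qᵏ⁺¹∣n

ord-exists : ∀ {q} .{{_ : NonTrivial q}} n .{{_ : NonZero n}} → ∃[ k ] IsOrd q n k
ord-exists {q} n = go n (<-wellFounded n)
  where
  instance
    q≢0 : NonZero q
    q≢0 = ℕ.nonTrivial⇒nonZero q

  go : ∀ n .{{_ : NonZero n}} → Acc _<_ n → ∃[ k ] IsOrd q n k
  go n (acc rec) with q ∣? n
  ... | no q∤n = 0 , 1∣ n , q∤n ∘ m*n∣⇒m∣ q 1
  ... | yes (divides m refl) with go m {{m*n≢0⇒m≢0 m}} (rec (m<m*n m q {{m*n≢0⇒m≢0 m}} (ℕ.nonTrivial⇒n>1 q)))
  ...   | k , qᵏ∣m , qᵏ⁺¹∤m = suc k , qᵏ⁺¹∣mq , qᵏ⁺²∤mq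
    where
    qᵏ⁺¹∣mq : q ^ suc k ∣ m * q
    qᵏ⁺¹∣mq = subst (_∣ m * q) (*-comm (q ^ k) q) (*-monoˡ-∣ q qᵏ∣m)
    qᵏ⁺²∤mq : ¬ q ^ suc (suc k) ∣ m * q
    qᵏ⁺²∤mq qᵏ⁺²∣mq = qᵏ⁺¹∤m (*-cancelʳ-∣ q (subst (_∣ m * q) (*-comm q (q ^ suc k)) qᵏ⁺²∣mq))

∃-prime-factor : ∀ n .{{_ : NonTrivial n}} → ∃[ p ] Prime p × p ∣ n
∃-prime-factor n with factorise n {{ℕ.nonTrivial⇒nonZero n}}
... | record { factors = [] ; isFactorisation = n≡1 } = contradiction n≡1 (>⇒≢ (ℕ.nonTrivial⇒n>1 n))
... | record { factors = p ∷ ps ; isFactorisation = n≡p*ps ; factorsPrime = prime-p ∷ _ } =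
  p , prime-p , subst (p ∣_) (sym n≡p*ps) (m∣m*n (product ps))

-- Write a = m * gcd a N.  A prime p ∣ m would give p ^ (1 + ord_p a) ∣ a,
-- because p ^ (ord_p a) divides both a and N, hence gcd a N.
∣-by-valuations : ∀ {a N} .{{_ : NonZero a}} → (∀ q k → Prime q → IsOrd q a k → q ^ k ∣ N) → a ∣ N
∣-by-valuations {a} {N} local with gcd[m,n]∣m a N
... | divides 0 a≡0 = contradiction a≡0 (ℕ.≢-nonZero⁻¹ a)
... | divides 1 a≡g = subst (_∣ N) (trans (sym (*-identityˡ _)) (sym a≡g)) (gcd[m,n]∣n a N)
... | divides m@(suc (suc _)) a≡mg with ∃-prime-factor m
...   | p , prime-p , p∣m with ord-exists {{prime⇒nonTrivial prime-p}} a
...     | k , pᵏ∣a , pᵏ⁺¹∤a = contradiction (subst (p ^ suc k ∣_) (sym a≡mg) (*-pres-∣ p∣m pᵏ∣g)) pᵏ⁺¹∤a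
  where
  pᵏ∣g : p ^ k ∣ gcd a N
  pᵏ∣g = gcd-greatest pᵏ∣a (local p k prime-p (pᵏ∣a , pᵏ⁺¹∤a))

-- With ν = ord_q d and μ = ord_q (d²−1), these say x ≤ ord_q (8(d²−1)) and
-- −y ≤ ord_q (4d(d²−1)) respectively.
NumeratorBound : ℕ → ℕ → ℤ → Set
NumeratorBound q μ x = x ℤ.≤ + μ ⊎ (q ≡ 2 × x ℤ.≤ + 3)

DenominatorBound : ℕ → ℕ → ℕ → ℤ → Set
DenominatorBound q ν μ y = - y ℤ.≤ + ν ⊎ - y ℤ.≤ + μ ⊎ (q ≡ 2 × - y ℤ.≤ + 2)

-[m-n]≤n : ∀ m n → - (+ m ℤ.- + n) ℤ.≤ + n
-[m-n]≤n m n = begin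
  - (+ m ℤ.- + n) ≡⟨ cong -_ (ℤP.[+m]-[+n]≡m⊖n m n) ⟩
  - (m ℤ.⊖ n)     ≡⟨ ℤP.⊖-swap n m ⟨
  n ℤ.⊖ m         ≤⟨ ℤP.m⊖n≤m n m ⟩
  + n             ∎
  where open ℤP.≤-Reasoning

+[n/2]≤+n : ∀ n → + (n / 2) ℤ.≤ + n
+[n/2]≤+n n = +≤+ (m/n≤m n 2)

≡ᵇ-true⇒≡ : ∀ {m n} → (m ≡ᵇ n) ≡ true → m ≡ n
≡ᵇ-true⇒≡ {m} {n} eq = ≡ᵇ⇒≡ m n (Equivalence.from T-≡ eq)

Tset-bounded : ∀ q ν μ → All (λ (x , y) → NumeratorBound q μ x × DenominatorBound q ν μ y) (Tset q ν μ)
Tset-bounded q ν μ with q ≡ᵇ 2 in q≡ᵇ2 | ν ≡ᵇ 0 | isEven μ | μ ≡ᵇ 0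
... | true  | true  | true  | _ =
      (inj₂ (≡ᵇ-true⇒≡ q≡ᵇ2 , +≤+ (s≤s z≤n)) , inj₁ (+≤+ z≤n))
    ∷ (inj₁ (+[n/2]≤+n μ) , inj₂ (inj₁ (ℤP.≤-trans (-[m-n]≤n 1 (μ / 2)) (+[n/2]≤+n μ))))
    ∷ (inj₂ (≡ᵇ-true⇒≡ q≡ᵇ2 , ℤP.i-j≤i (+ 3) (+ μ)) , inj₂ (inj₂ (≡ᵇ-true⇒≡ q≡ᵇ2 , -[m-n]≤n μ 2)))
    ∷ []
... | true  | true  | false | _ =
      (inj₂ (≡ᵇ-true⇒≡ q≡ᵇ2 , +≤+ (s≤s z≤n)) , inj₁ (+≤+ z≤n))
    ∷ (inj₂ (≡ᵇ-true⇒≡ q≡ᵇ2 , ℤP.i-j≤i (+ 3) (+ μ)) , inj₂ (inj₂ (≡ᵇ-true⇒≡ q≡ᵇ2 , -[m-n]≤n μ 2)))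
    ∷ []
... | true  | false | _     | _ =
      (inj₁ (+≤+ z≤n) , inj₁ (-[m-n]≤n 1 ν)) ∷ []
... | false | false | _     | _ =
      (inj₁ ℤP.neg-≤-pos , inj₁ (+≤+ z≤n))
    ∷ (inj₁ (+≤+ z≤n) , inj₁ (ℤP.≤-reflexive (ℤP.neg-involutive (+ ν))))
    ∷ []
... | false | true  | true  | false =
      (inj₁ (+≤+ z≤n) , inj₁ (+≤+ z≤n))
    ∷ (inj₁ ℤP.neg-≤-pos , inj₂ (inj₁ ℤP.neg-≤-pos))
    ∷ (inj₁ (+[n/2]≤+n μ) , inj₂ (inj₁ (ℤP.≤-trans (ℤP.≤-reflexive (ℤP.neg-involutive _)) (+[n/2]≤+n μ))))
    ∷ []
... | false | true  | false | false =
      (inj₁ (+≤+ z≤n) , inj₁ (+≤+ z≤n))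
    ∷ (inj₁ ℤP.neg-≤-pos , inj₂ (inj₁ ℤP.neg-≤-pos))
    ∷ []
... | false | true  | _     | true =
      (inj₁ (+≤+ z≤n) , inj₁ (+≤+ z≤n)) ∷ []

NumeratorBound⇒∣ : ∀ {q μ D j} → q ^ μ ∣ D → NumeratorBound q μ (+ j) → q ^ j ∣ 8 * D
NumeratorBound⇒∣ {q} qᵘ∣D (inj₁ (+≤+ j≤μ)) = ∣-trans (m≤n⇒q^m∣q^n q j≤μ) (∣-trans qᵘ∣D (n∣m*n 8))
NumeratorBound⇒∣ {D = D} _ (inj₂ (refl , +≤+ j≤3)) = ∣-trans (m≤n⇒q^m∣q^n 2 j≤3) (m∣m*n D)

DenominatorBound⇒∣ : ∀ {q ν μ d D j} → q ^ ν ∣ d → q ^ μ ∣ D →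
                     DenominatorBound q ν μ -[1+ j ] → q ^ suc j ∣ 4 * d * D
DenominatorBound⇒∣ {q} {D = D} qᵛ∣d _ (inj₁ (+≤+ j<ν)) =
  ∣-trans (m≤n⇒q^m∣q^n q j<ν) (∣-trans qᵛ∣d (n∣m*n*o 4 D))
DenominatorBound⇒∣ {q} {d = d} _ qᵘ∣D (inj₂ (inj₁ (+≤+ j<μ))) =
  ∣-trans (m≤n⇒q^m∣q^n q j<μ) (∣-trans qᵘ∣D (n∣m*n (4 * d)))
DenominatorBound⇒∣ {d = d} {D} _ _ (inj₂ (inj₂ (refl , +≤+ j<2))) =
  ∣-trans (m≤n⇒q^m∣q^n 2 j<2) (∣m⇒∣m*n D (m∣m*n d))

coprime⇒∤ : ∀ {q m n} → Prime q → Coprime m n → q ∣ m → ¬ q ∣ n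
coprime⇒∤ prime-q coprime q∣m q∣n = ℕ.nonTrivial⇒≢1 {{prime⇒nonTrivial prime-q}} (coprime (q∣m , q∣n))

↥-↧-coprime : ∀ p → Coprime ℤ.∣ ↥ p ∣ (↧ₙ p)
↥-↧-coprime (mkℚ _ _ coprime) = Coprimality.recompute coprime

OrdQ-exists : ∀ {q} → Prime q → ∀ p .{{_ : NonZero ℤ.∣ ↥ p ∣}} → ∃[ x ] OrdQ q p x
OrdQ-exists prime-q p
  with ord-exists {{prime⇒nonTrivial prime-q}} ℤ.∣ ↥ p ∣ | ord-exists {{prime⇒nonTrivial prime-q}} (↧ₙ p)
... | a , ord-↥ | b , ord-↧ = + a ℤ.- + b , a , b , ord-↥ , ord-↧ , refl

OrdQ-numerator : ∀ {q} → Prime q → ∀ p j → IsOrd q ℤ.∣ ↥ p ∣ (suc j) → OrdQ q p (+ suc j)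
OrdQ-numerator prime-q p j ord-↥ with ord-exists {{prime⇒nonTrivial prime-q}} (↧ₙ p)
... | zero  , ord-↧ = suc j , 0 , ord-↥ , ord-↧ , sym (ℤP.+-identityʳ (+ suc j))
... | suc k , ord-↧ =
  contradiction (IsOrd-suc⇒∣ k ord-↧) (coprime⇒∤ prime-q (↥-↧-coprime p) (IsOrd-suc⇒∣ j ord-↥))

OrdQ-denominator : ∀ {q} → Prime q → ∀ p .{{_ : NonZero ℤ.∣ ↥ p ∣}} j → IsOrd q (↧ₙ p) (suc j) → OrdQ q p -[1+ j ]
OrdQ-denominator prime-q p j ord-↧ with ord-exists {{prime⇒nonTrivial prime-q}} ℤ.∣ ↥ p ∣
... | zero  , ord-↥ = 0 , suc j , ord-↥ , ord-↧ , refl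
... | suc k , ord-↥ =
  contradiction (IsOrd-suc⇒∣ j ord-↧) (coprime⇒∤ prime-q (↥-↧-coprime p) (IsOrd-suc⇒∣ k ord-↥))

0<p⇒∣↥p∣≢0 : ∀ {p} → 0ℚ ℚ.< p → NonZero ℤ.∣ ↥ p ∣
0<p⇒∣↥p∣≢0 {mkℚ _ _ _} 0<p = ℚ.>-nonZero 0<p

0<p⇒+∣↥p∣≡↥p : ∀ {p} → 0ℚ ℚ.< p → + ℤ.∣ ↥ p ∣ ≡ ↥ p
0<p⇒+∣↥p∣≡↥p {mkℚ (+ _)     _ _} _            = refl
0<p⇒+∣↥p∣≡↥p {mkℚ -[1+ _ ] _ _} (ℚ.*<* ())

1<d⇒d*d∸1≢0 : ∀ {d} → 1 < d → NonZero (d * d ∸ 1)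
1<d⇒d*d∸1≢0 1<d = ℕ.>-nonZero (≤-trans (s≤s z≤n) (∸-monoˡ-≤ 1 (*-mono-≤ 1<d 1<d)))

module _ {d : ℕ} {α β : ℚ} (1<d : 1 < d) (A : InA d α β) where

  private
    D = d * d ∸ 1

    instance
      d≢0 : NonZero d
      d≢0 = ℕ.>-nonZero (<-trans (s≤s z≤n) 1<d)
      D≢0 : NonZero D
      D≢0 = 1<d⇒d*d∸1≢0 1<d
      ↥α≢0 : NonZero ℤ.∣ ↥ α ∣
      ↥α≢0 = 0<p⇒∣↥p∣≢0 (proj₁ A)
      ↥β≢0 : NonZero ℤ.∣ ↥ β ∣
      ↥β≢0 = 0<p⇒∣↥p∣≢0 (proj₁ (proj₂ A))

    valuation-bounds : ∀ {q x y} ν μ → Prime q → IsOrd q d ν → IsOrd q D μ → OrdQ q α x → OrdQ q β y →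
                       NumeratorBound q μ x × DenominatorBound q ν μ y
    valuation-bounds {q} {x} {y} ν μ prime-q ord-d ord-D ord-α ord-β =
      lookup (Tset-bounded q ν μ) (proj₂ (proj₂ A) q prime-q ν μ x y ord-d ord-D ord-α ord-β)

  InA⇒numerator∣ : ℤ.∣ ↥ α ∣ ∣ 8 * D
  InA⇒numerator∣ = ∣-by-valuations local
    where
    local : ∀ q k → Prime q → IsOrd q ℤ.∣ ↥ α ∣ k → q ^ k ∣ 8 * D
    local _ zero    _       _     = 1∣ _
    local q (suc j) prime-q ord-α =
      let ν , ord-d = ord-exists d
          μ , ord-D = ord-exists D
          y , ord-β = OrdQ-exists prime-q β
      in NumeratorBound⇒∣ (proj₁ ord-D)
           (proj₁ (valuation-bounds ν μ prime-q ord-d ord-D (OrdQ-numerator prime-q α j ord-α) ord-β))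
      where
      instance
        q-nonTrivial : NonTrivial q
        q-nonTrivial = prime⇒nonTrivial prime-q

  InA⇒denominator∣ : ↧ₙ β ∣ 4 * d * D
  InA⇒denominator∣ = ∣-by-valuations local
    where
    local : ∀ q k → Prime q → IsOrd q (↧ₙ β) k → q ^ k ∣ 4 * d * D
    local _ zero    _       _     = 1∣ _
    local q (suc j) prime-q ord-β =
      let ν , ord-d = ord-exists d
          μ , ord-D = ord-exists D
          x , ord-α = OrdQ-exists prime-q α
      in DenominatorBound⇒∣ (proj₁ ord-d) (proj₁ ord-D)
           (proj₂ (valuation-bounds ν μ prime-q ord-d ord-D ord-α (OrdQ-denominator prime-q β j ord-β)))
      where
      instance
        q-nonTrivial : NonTrivial q
        q-nonTrivial = prime⇒nonTrivial prime-q

∣z∣-coprime-1 : ∀ z → Coprime ℤ.∣ z ∣ 1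
∣z∣-coprime-1 z = Coprimality.sym (Coprimality.1-coprimeTo ℤ.∣ z ∣)

ℤtoℚ≡mkℚ : ∀ z → ℤtoℚ z ≡ mkℚ z 0 (∣z∣-coprime-1 z)
ℤtoℚ≡mkℚ z = ↥p/↧p≡p (mkℚ z 0 _)

ℤtoℚ-* : ∀ x y → ℤtoℚ x ℚ.* ℤtoℚ y ≡ ℤtoℚ (x ℤ.* y)
ℤtoℚ-* x y rewrite ℤtoℚ≡mkℚ x | ℤtoℚ≡mkℚ y = refl

ℤtoℚ-^ℚ : ∀ z n → ℤtoℚ z ^ℚ n ≡ ℤtoℚ (z ℤ.^ n)
ℤtoℚ-^ℚ z zero    = refl
ℤtoℚ-^ℚ z (suc n) = trans (cong (ℤtoℚ z ℚ.*_) (ℤtoℚ-^ℚ z n)) (ℤtoℚ-* z (z ℤ.^ n))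

pos-^ : ∀ m n → (+ m) ℤ.^ n ≡ + (m ^ n)
pos-^ m zero    = refl
pos-^ m (suc n) = trans (cong (+ m ℤ.*_) (pos-^ m n)) (sym (ℤP.pos-* m (m ^ n)))

i^2≡+∣i∣^2 : ∀ i → i ℤ.^ 2 ≡ + (ℤ.∣ i ∣ ^ 2)
i^2≡+∣i∣^2 (+ n)    = pos-^ n 2
i^2≡+∣i∣^2 -[1+ n ] = refl

i^[2n]≡+[∣i∣^2]^n : ∀ i n → i ℤ.^ (2 * n) ≡ + ((ℤ.∣ i ∣ ^ 2) ^ n)
i^[2n]≡+[∣i∣^2]^n i n = begin
  i ℤ.^ (2 * n)           ≡⟨ ℤP.^-*-assoc i 2 n ⟨
  (i ℤ.^ 2) ℤ.^ n         ≡⟨ cong (ℤ._^ n) (i^2≡+∣i∣^2 i) ⟩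
  (+ (ℤ.∣ i ∣ ^ 2)) ℤ.^ n ≡⟨ pos-^ (ℤ.∣ i ∣ ^ 2) n ⟩
  + ((ℤ.∣ i ∣ ^ 2) ^ n)   ∎
  where open ≡-Reasoning

ℤtoℚ-^ℚ-nonNeg : ∀ {i} → + 0 ℤ.≤ i → ∀ n → ℤtoℚ i ^ℚ n ≡ ℤtoℚ (+ (ℤ.∣ i ∣ ^ n))
ℤtoℚ-^ℚ-nonNeg {i} 0≤i n = begin
  ℤtoℚ i ^ℚ n             ≡⟨ ℤtoℚ-^ℚ i n ⟩
  ℤtoℚ (i ℤ.^ n)          ≡⟨ cong (λ j → ℤtoℚ (j ℤ.^ n)) (ℤP.0≤i⇒+∣i∣≡i 0≤i) ⟨
  ℤtoℚ ((+ ℤ.∣ i ∣) ℤ.^ n) ≡⟨ cong ℤtoℚ (pos-^ ℤ.∣ i ∣ n) ⟩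
  ℤtoℚ (+ (ℤ.∣ i ∣ ^ n))   ∎
  where open ≡-Reasoning

ℤtoℚ-^ℚ-even : ∀ i n → ℤtoℚ i ^ℚ (2 * n) ≡ ℤtoℚ (+ ((ℤ.∣ i ∣ ^ 2) ^ n))
ℤtoℚ-^ℚ-even i n = trans (ℤtoℚ-^ℚ i (2 * n)) (cong ℤtoℚ (i^[2n]≡+[∣i∣^2]^n i n))

clear-denominators : ∀ (p q : ℚ) (Y₂ Y₁ D : ℤ) →
  ℤtoℚ (+ 4) ℚ.* p ℚ.* ℤtoℚ Y₂ ℚ.- (q ℚ.* q) ℚ.* ℤtoℚ Y₁ ≡ ℤtoℚ D →
  + 4 ℤ.* ↥ p ℤ.* (↧ q ℤ.* ↧ q) ℤ.* Y₂ ≡ ↥ q ℤ.* ↥ q ℤ.* ↧ p ℤ.* Y₁ ℤ.+ D ℤ.* ↧ p ℤ.* (↧ q ℤ.* ↧ q)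
clear-denominators p@(mkℚ C e _) q@(mkℚ A b _) Y₂ Y₁ D eq
  rewrite ℤtoℚ≡mkℚ (+ 4) | ℤtoℚ≡mkℚ Y₂ | ℤtoℚ≡mkℚ Y₁ | ℤtoℚ≡mkℚ D
  with ℚᵘP.≃-trans (ℚᵘP.≃-sym toℚᵘ-lhs) (toℚᵘ-cong eq)
  where
  four = mkℚ (+ 4) 0 (∣z∣-coprime-1 (+ 4))
  y₂ = mkℚ Y₂ 0 (∣z∣-coprime-1 Y₂)
  y₁ = mkℚ Y₁ 0 (∣z∣-coprime-1 Y₁)
  toℚᵘ-lhs : toℚᵘ (four ℚ.* p ℚ.* y₂ ℚ.- q ℚ.* q ℚ.* y₁)
               ℚᵘ.≃ toℚᵘ four ℚᵘ.* toℚᵘ p ℚᵘ.* toℚᵘ y₂ ℚᵘ.- toℚᵘ q ℚᵘ.* toℚᵘ q ℚᵘ.* toℚᵘ y₁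
  toℚᵘ-lhs = ℚᵘP.≃-trans (toℚᵘ-homo-+ (four ℚ.* p ℚ.* y₂) (ℚ.- (q ℚ.* q ℚ.* y₁)))
    (ℚᵘP.+-cong
      (ℚᵘP.≃-trans (toℚᵘ-homo-* (four ℚ.* p) y₂) (ℚᵘP.*-cong (toℚᵘ-homo-* four p) ℚᵘP.≃-refl))
      (ℚᵘP.≃-trans (toℚᵘ-homo‿- (q ℚ.* q ℚ.* y₁))
        (ℚᵘP.-‿cong (ℚᵘP.≃-trans (toℚᵘ-homo-* (q ℚ.* q) y₁) (ℚᵘP.*-cong (toℚᵘ-homo-* q q) ℚᵘP.≃-refl)))))
... | ℚᵘ.*≡* cross = ℤP.i-j≡0⇒i≡j _ _ (begin
  lhs ℤ.- rhs             ≡⟨ rearrange C A E B Y₂ Y₁ D ⟩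
  ↥L ℤ.* + 1 ℤ.- D ℤ.* ↧L ≡⟨ cong (ℤ._- D ℤ.* ↧L) cross ⟩
  D ℤ.* ↧L ℤ.- D ℤ.* ↧L   ≡⟨ ℤP.+-inverseʳ (D ℤ.* ↧L) ⟩
  + 0                     ∎)
  where
  open ≡-Reasoning
  E = + suc e
  B = + suc b
  lhs = + 4 ℤ.* C ℤ.* (B ℤ.* B) ℤ.* Y₂
  rhs = A ℤ.* A ℤ.* E ℤ.* Y₁ ℤ.+ D ℤ.* E ℤ.* (B ℤ.* B)
  -- ↥L / ↧L is the left-hand side as ℚᵘ computes it, unit denominators included
  ↥L = + 4 ℤ.* C ℤ.* Y₂ ℤ.* (B ℤ.* B ℤ.* + 1) ℤ.+ - (A ℤ.* A ℤ.* Y₁) ℤ.* (+ 1 ℤ.* E ℤ.* + 1)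
  ↧L = (+ 1 ℤ.* E ℤ.* + 1) ℤ.* (B ℤ.* B ℤ.* + 1)
  rearrange : ∀ C A E B Y₂ Y₁ D →
    + 4 ℤ.* C ℤ.* (B ℤ.* B) ℤ.* Y₂ ℤ.- (A ℤ.* A ℤ.* E ℤ.* Y₁ ℤ.+ D ℤ.* E ℤ.* (B ℤ.* B))
      ≡ (+ 4 ℤ.* C ℤ.* Y₂ ℤ.* (B ℤ.* B ℤ.* + 1) ℤ.+ - (A ℤ.* A ℤ.* Y₁) ℤ.* (+ 1 ℤ.* E ℤ.* + 1)) ℤ.* + 1
        ℤ.- D ℤ.* ((+ 1 ℤ.* E ℤ.* + 1) ℤ.* (B ℤ.* B ℤ.* + 1))
  rearrange = ℤ-Ring.solve-∀

cleared-equation⇒bound : ∀ {a b c e D N S} .{{_ : NonZero b}} .{{_ : NonZero c}} .{{_ : NonZero S}} →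
  4 * c * (b * b) * N ≡ a * a * e * S + D * e * (b * b) → N ≤ (a * a + D) * e * S
cleared-equation⇒bound {a} {b} {c} {e} {D} {N} {S} eq = *-cancelˡ-≤ (b * b) {{m*n≢0 b b}} (begin
  b * b * N                                     ≤⟨ m≤n*m (b * b * N) (4 * c) {{m*n≢0 4 c}} ⟩
  4 * c * (b * b * N)                           ≡⟨ *-assoc (4 * c) (b * b) N ⟨
  4 * c * (b * b) * N                           ≡⟨ eq ⟩
  a * a * e * S + D * e * (b * b)               ≤⟨ +-mono-≤ (m≤n*m (a * a * e * S) (b * b) {{m*n≢0 b b}})
                                                            (m≤m*n (D * e * (b * b)) S) ⟩
  b * b * (a * a * e * S) + D * e * (b * b) * S ≡⟨ collect a b e D S ⟩
  b * b * ((a * a + D) * e * S)                 ∎)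
  where
  open ≤-Reasoning
  collect : ∀ a b e D S → b * b * (a * a * e * S) + D * e * (b * b) * S ≡ b * b * ((a * a + D) * e * S)
  collect = ℕ-Ring.solve-∀

height-bound : ∀ {α β : ℚ} {N S D : ℕ} .{{_ : NonZero S}} → 0ℚ ℚ.< α → 0ℚ ℚ.< β →
  ℤtoℚ (+ 4) ℚ.* β ℚ.* ℤtoℚ (+ N) ℚ.- (α ℚ.* α) ℚ.* ℤtoℚ (+ S) ≡ ℤtoℚ (+ D) →
  N ≤ (ℤ.∣ ↥ α ∣ * ℤ.∣ ↥ α ∣ + D) * ↧ₙ β * S
height-bound {α} {β} {N} {S} {D} 0<α 0<β eq =
  cleared-equation⇒bound {a} {b} {c} {e} {D} {N} {S} {{_}} {{0<p⇒∣↥p∣≢0 0<β}} (ℤP.+-injective (begin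
    + (4 * c * (b * b) * N)                                         ≡⟨ lhs-cast ⟩
    + 4 ℤ.* ↥ β ℤ.* (↧ α ℤ.* ↧ α) ℤ.* + N                           ≡⟨ clear-denominators β α (+ N) (+ S) (+ D) eq ⟩
    ↥ α ℤ.* ↥ α ℤ.* ↧ β ℤ.* + S ℤ.+ + D ℤ.* ↧ β ℤ.* (↧ α ℤ.* ↧ α) ≡⟨ rhs-cast ⟨
    + (a * a * e * S + D * e * (b * b))                             ∎))
  where
  open ≡-Reasoning
  a = ℤ.∣ ↥ α ∣
  b = ↧ₙ α
  c = ℤ.∣ ↥ β ∣
  e = ↧ₙ β
  pos-*³ : ∀ x y z → + (x * y * z) ≡ + x ℤ.* + y ℤ.* + z
  pos-*³ x y z = trans (ℤP.pos-* (x * y) z) (cong (ℤ._* + z) (ℤP.pos-* x y))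
  lhs-cast : + (4 * c * (b * b) * N) ≡ + 4 ℤ.* ↥ β ℤ.* (↧ α ℤ.* ↧ α) ℤ.* + N
  lhs-cast = begin
    + (4 * c * (b * b) * N)               ≡⟨ pos-*³ (4 * c) (b * b) N ⟩
    + (4 * c) ℤ.* + (b * b) ℤ.* + N       ≡⟨ cong₂ (λ x y → x ℤ.* y ℤ.* + N) (ℤP.pos-* 4 c) (ℤP.pos-* b b) ⟩
    + 4 ℤ.* + c ℤ.* (↧ α ℤ.* ↧ α) ℤ.* + N ≡⟨ cong (λ x → + 4 ℤ.* x ℤ.* (↧ α ℤ.* ↧ α) ℤ.* + N) (0<p⇒+∣↥p∣≡↥p 0<β) ⟩
    + 4 ℤ.* ↥ β ℤ.* (↧ α ℤ.* ↧ α) ℤ.* + N ∎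
  rhs-cast : + (a * a * e * S + D * e * (b * b)) ≡ ↥ α ℤ.* ↥ α ℤ.* ↧ β ℤ.* + S ℤ.+ + D ℤ.* ↧ β ℤ.* (↧ α ℤ.* ↧ α)
  rhs-cast = begin
    + (a * a * e * S + D * e * (b * b))
      ≡⟨ ℤP.pos-+ (a * a * e * S) (D * e * (b * b)) ⟩
    + (a * a * e * S) ℤ.+ + (D * e * (b * b))
      ≡⟨ cong₂ ℤ._+_ (pos-*³ (a * a) e S) (pos-*³ D e (b * b)) ⟩
    + (a * a) ℤ.* + e ℤ.* + S ℤ.+ + D ℤ.* + e ℤ.* + (b * b)
      ≡⟨ cong₂ ℤ._+_ (cong (λ x → x ℤ.* + e ℤ.* + S) (ℤP.pos-* a a)) (cong (+ D ℤ.* + e ℤ.*_) (ℤP.pos-* b b)) ⟩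
    + a ℤ.* + a ℤ.* ↧ β ℤ.* + S ℤ.+ + D ℤ.* ↧ β ℤ.* (↧ α ℤ.* ↧ α)
      ≡⟨ cong (λ x → x ℤ.* x ℤ.* ↧ β ℤ.* + S ℤ.+ + D ℤ.* ↧ β ℤ.* (↧ α ℤ.* ↧ α)) (0<p⇒+∣↥p∣≡↥p 0<α) ⟩
    ↥ α ℤ.* ↥ α ℤ.* ↧ β ℤ.* + S ℤ.+ + D ℤ.* ↧ β ℤ.* (↧ α ℤ.* ↧ α)
      ∎

^-distribʳ-* : ∀ m n o → (m * n) ^ o ≡ m ^ o * n ^ o
^-distribʳ-* m n zero    = refl
^-distribʳ-* m n (suc o) =
  trans (cong (m * n *_) (^-distribʳ-* m n o)) ([m*n]*[o*p]≡[m*o]*[n*p] m n (m ^ o) (n ^ o))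

[m^n]^o≡[m^o]^n : ∀ m n o → (m ^ n) ^ o ≡ (m ^ o) ^ n
[m^n]^o≡[m^o]^n m n o = trans (^-*-assoc m n o) (trans (cong (m ^_) (*-comm n o)) (sym (^-*-assoc m o n)))

root-bound : ∀ {n s K} m r ℓ .{{_ : NonZero ℓ}} → n ^ ℓ ≤ K * s ^ ℓ → K ^ m ≤ (s ^ r) ^ ℓ → n ^ m ≤ s ^ (r + m)
root-bound {n} {s} {K} m r ℓ nˡ≤Ksˡ Kᵐ≤sʳˡ = ≮⇒≥ (λ sʳ⁺ᵐ<nᵐ → <⇒≱ (^-monoˡ-< ℓ sʳ⁺ᵐ<nᵐ) ℓ-th-powers)
  where
  open ≤-Reasoning
  ℓ-th-powers : (n ^ m) ^ ℓ ≤ (s ^ (r + m)) ^ ℓ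
  ℓ-th-powers = begin
    (n ^ m) ^ ℓ               ≡⟨ [m^n]^o≡[m^o]^n n m ℓ ⟩
    (n ^ ℓ) ^ m               ≤⟨ ^-monoˡ-≤ m nˡ≤Ksˡ ⟩
    (K * s ^ ℓ) ^ m           ≡⟨ ^-distribʳ-* K (s ^ ℓ) m ⟩
    K ^ m * (s ^ ℓ) ^ m       ≤⟨ *-monoˡ-≤ ((s ^ ℓ) ^ m) Kᵐ≤sʳˡ ⟩
    (s ^ r) ^ ℓ * (s ^ ℓ) ^ m ≡⟨ cong ((s ^ r) ^ ℓ *_) ([m^n]^o≡[m^o]^n s ℓ m) ⟩
    (s ^ r) ^ ℓ * (s ^ m) ^ ℓ ≡⟨ ^-distribʳ-* (s ^ r) (s ^ m) ℓ ⟨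
    (s ^ r * s ^ m) ^ ℓ       ≡⟨ cong (_^ ℓ) (^-distribˡ-+-* s r m) ⟨
    (s ^ (r + m)) ^ ℓ         ∎

⊔-^-≤ : ∀ {m n k o} → m ^ k ≤ o → n ^ k ≤ o → (m ⊔ n) ^ k ≤ o
⊔-^-≤ {m} {n} mᵏ≤o nᵏ≤o with ⊔-sel m n
... | inj₁ m⊔n≡m rewrite m⊔n≡m = mᵏ≤o
... | inj₂ m⊔n≡n rewrite m⊔n≡n = nᵏ≤o

-- For d ≤ 50: a ≤ 8(d²−1) ≤ 8 · 2499, d² − 1 ≤ 2499 and e ≤ 4d(d²−1) ≤ 4 · 50 · 2499.
Kmax : ℕ
Kmax = (8 * 2499 * (8 * 2499) + 2499) * (4 * 50 * 2499)

Kmax^100≤64^1001 : Kmax ^ 100 ≤ 64 ^ 1001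
Kmax^100≤64^1001 = ≤ᵇ⇒≤ (Kmax ^ 100) (64 ^ 1001) _

K^100≤[s^3]^ℓ : ∀ {K s ℓ} → K ≤ Kmax → 4 ≤ s → 1000 < ℓ → K ^ 100 ≤ (s ^ 3) ^ ℓ
K^100≤[s^3]^ℓ {K} {s} {ℓ} K≤Kmax 4≤s 1000<ℓ = begin
  K ^ 100     ≤⟨ ^-monoˡ-≤ 100 K≤Kmax ⟩
  Kmax ^ 100  ≤⟨ Kmax^100≤64^1001 ⟩
  64 ^ 1001   ≤⟨ ^-monoʳ-≤ 64 1000<ℓ ⟩
  64 ^ ℓ      ≤⟨ ^-monoˡ-≤ ℓ (^-monoˡ-≤ 3 4≤s) ⟩
  (s ^ 3) ^ ℓ ∎
  where open ≤-Reasoning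

[a*a+D]*e-mono-≤ : ∀ {a A D M e E} → a ≤ A → D ≤ M → e ≤ E → (a * a + D) * e ≤ (A * A + M) * E
[a*a+D]*e-mono-≤ a≤A D≤M e≤E = *-mono-≤ (+-mono-≤ (*-mono-≤ a≤A a≤A) D≤M) e≤E

d*d∸1≤2499 : ∀ {d} → d ≤ 50 → d * d ∸ 1 ≤ 2499
d*d∸1≤2499 d≤50 = ∸-monoˡ-≤ 1 (*-mono-≤ d≤50 d≤50)

-- The bounds are passed explicitly: inferring them would make the unifier
-- unfold the large literals in unary.
coefficient-bound : ∀ {d α β} → 1 < d → d ≤ 50 → InA d α β →
                    (ℤ.∣ ↥ α ∣ * ℤ.∣ ↥ α ∣ + (d * d ∸ 1)) * ↧ₙ β ≤ Kmax
coefficient-bound {d} {α} {β} 1<d d≤50 A =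
  [a*a+D]*e-mono-≤ {A = 8 * 2499} {M = 2499} {E = 4 * 50 * 2499} a≤ (d*d∸1≤2499 d≤50) e≤
  where
  instance
    d≢0 : NonZero d
    d≢0 = ℕ.>-nonZero (<-trans (s≤s z≤n) 1<d)
    D≢0 : NonZero (d * d ∸ 1)
    D≢0 = 1<d⇒d*d∸1≢0 1<d
  a≤ : ℤ.∣ ↥ α ∣ ≤ 8 * 2499
  a≤ = ≤-trans (∣⇒≤ {{m*n≢0 8 _}} (InA⇒numerator∣ 1<d A)) (*-monoʳ-≤ 8 (d*d∸1≤2499 d≤50))
  e≤ : ↧ₙ β ≤ 4 * 50 * 2499
  e≤ = ≤-trans (∣⇒≤ {{m*n≢0 (4 * d) _ {{m*n≢0 4 d}}}} (InA⇒denominator∣ 1<d A))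
               (*-mono-≤ (*-monoʳ-≤ 4 d≤50) (d*d∸1≤2499 d≤50))

lemma5p3 : (d : ℕ) → 3 ≤ d → d ≤ 50 → (ℓ : ℕ) → Prime ℓ → 1000 ℕ.< ℓ →
    (α β : ℚ) → InA d α β → (y₁ y₂ : ℤ) →
    (ℤtoℚ (+ 4) ℚ.* β ℚ.* (ℤtoℚ y₂ ^ℚ ℓ) ℚ.- (α ℚ.* α) ℚ.* (ℤtoℚ y₁ ^ℚ (2 ℕ.* ℓ)) ≡ ℤtoℚ (+ (d ℕ.* d ∸ 1))) →
    2 ≤ ℤ.∣ y₁ ∣ → + 2 ℤ.≤ y₂ → y₂ ≢ y₁ ℤ.* y₁ →
    (ℤ.∣ y₁ ∣ ℕ.^ 2 ≤ (ℤ.∣ y₁ ∣ ℕ.^ 2) ⊔ ℤ.∣ y₂ ∣)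
    × (((ℤ.∣ y₁ ∣ ℕ.^ 2) ⊔ ℤ.∣ y₂ ∣) ℕ.^ 100 ≤ (ℤ.∣ y₁ ∣ ℕ.^ 2) ℕ.^ 103)
lemma5p3 d 3≤d d≤50 ℓ _ 1000<ℓ α β A@(0<α , 0<β , _) y₁ y₂ eq 2≤∣y₁∣ 2≤y₂ _ =
  m≤m⊔n s n₂ , ⊔-^-≤ {s} {n₂} {100} {s ^ 103} (^-monoʳ-≤ s (m≤m+n 100 3)) n₂¹⁰⁰≤s¹⁰³
  where
  s = ℤ.∣ y₁ ∣ ^ 2
  n₂ = ℤ.∣ y₂ ∣
  K = (ℤ.∣ ↥ α ∣ * ℤ.∣ ↥ α ∣ + (d * d ∸ 1)) * ↧ₙ β
  4≤s : 4 ≤ s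
  4≤s = ^-monoˡ-≤ 2 2≤∣y₁∣
  instance
    s≢0 : NonZero s
    s≢0 = ℕ.>-nonZero (≤-trans (s≤s z≤n) 4≤s)
    sˡ≢0 : NonZero (s ^ ℓ)
    sˡ≢0 = m^n≢0 s ℓ
    ℓ≢0 : NonZero ℓ
    ℓ≢0 = ℕ.>-nonZero (≤-trans (s≤s z≤n) 1000<ℓ)
  integral-eq : ℤtoℚ (+ 4) ℚ.* β ℚ.* ℤtoℚ (+ (n₂ ^ ℓ)) ℚ.- (α ℚ.* α) ℚ.* ℤtoℚ (+ (s ^ ℓ)) ≡ ℤtoℚ (+ (d * d ∸ 1))
  integral-eq = subst₂ (λ Y₂ Y₁ → ℤtoℚ (+ 4) ℚ.* β ℚ.* Y₂ ℚ.- (α ℚ.* α) ℚ.* Y₁ ≡ ℤtoℚ (+ (d * d ∸ 1)))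
                       (ℤtoℚ-^ℚ-nonNeg (ℤP.≤-trans (+≤+ z≤n) 2≤y₂) ℓ) (ℤtoℚ-^ℚ-even y₁ ℓ) eq
  n₂¹⁰⁰≤s¹⁰³ : n₂ ^ 100 ≤ s ^ 103
  n₂¹⁰⁰≤s¹⁰³ = root-bound {n₂} {s} {K} 100 3 ℓ
                 (height-bound {α} {β} {n₂ ^ ℓ} {s ^ ℓ} {d * d ∸ 1} 0<α 0<β integral-eq)
                 (K^100≤[s^3]^ℓ {K} (coefficient-bound (<⇒≤ 3≤d) d≤50 A) 4≤s 1000<ℓ)
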